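{- For every integer $n\ge 0$, $$\Phi(G_n)=\frac{5-3\sqrt{5}}{10}(3-\sqrt{5})^n+\frac{5+3\sqrt{5}}{10}(3+\sqrt{5})^n.$$
   Context: For a graph $G$, $\Phi(G)$ denotes the number of perfect matchings of $G$. For a positive integer $n$, $G_n$ is the plane graph (a polyomino graph with $4n$ unit square faces) with vertex set $\{u_0,v_0\}\cup\{u_i,v_i,w_i,z_i: 1\le i\le 2n\}$, drawn with $w_i$ at $(i,3)$, $u_i$ at $(i,2)$, $v_i$ at $(i,1)$, $z_i$ at $(i,0)$ (and $u_0$ at $(0,2)$, $v_0$ at $(0,1)$), and edge set consisting of: $u_{i-1}u_i$ and $v_{i-1}v_i$ for $1\le i\le 2n$; $u_iv_i$ for $0\le i\le 2n$; $w_iu_i$ and $v_iz_i$ for $1\le i\le 2n$; $w_{2j-1}w_{2j}$ and $z_{2j-1}z_{2j}$ for $1\le j\le n$. $G_0$ denotes the null graph, with $\Phi(G_0)=1$. -}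

module Defs where

open import Data.Nat using (ℕ; zero; suc; _+_; _*_; _≡ᵇ_)
open import Data.Bool using (Bool; true; false; _∧_; _∨_)
open import Data.List using (List; []; _∷_; _++_; map; length; filterᵇ; applyUpTo; concat)
open import Data.Bool.ListAction using (and)
open import Data.Product using (_×_; _,_; proj₁; proj₂)
open import Data.Integer using (ℤ; +_) renaming (_+_ to _+ℤ_; _*_ to _*ℤ_)

-- Vertices of G_n: u_i, v_i (0 ≤ i ≤ 2n), w_i, z_i (1 ≤ i ≤ 2n)

data Vtx : Set where
  u v w z : ℕ → Vtx

_==_ : Vtx → Vtx → Bool
u i == u j = i ≡ᵇ j
v i == v j = i ≡ᵇ j
w i == w j = i ≡ᵇ j
z i == z j = i ≡ᵇ j
_   == _   = false

Edge : Set
Edge = Vtx × Vtx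

record Graph : Set where
  field
    verts : List Vtx
    edges : List Edge
open Graph public

G : ℕ → Graph
G zero = record { verts = [] ; edges = [] }
G (suc k) = record { verts = vs ; edges = es }
  where
  n = suc k
  m = 2 * n
  one-to : List ℕ
  one-to = applyUpTo suc m
  zero-to : List ℕ
  zero-to = applyUpTo (λ i → i) (suc m)
  vs : List Vtx
  vs = map u zero-to ++ map v zero-to ++ map w one-to ++ map z one-to
  es : List Edge
  es = concat (map (λ i → (u (i Data.Nat.∸ 1) , u i) ∷ (v (i Data.Nat.∸ 1) , v i) ∷ []) one-to)
    ++ map (λ i → (u i , v i)) zero-to
    ++ concat (map (λ i → (w i , u i) ∷ (v i , z i) ∷ []) one-to)
    ++ concat (map (λ j → (w (2 * j + 1) , w (2 * j + 2)) ∷ (z (2 * j + 1) , z (2 * j + 2)) ∷ [])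
                   (applyUpTo (λ i → i) n))

sublists : {A : Set} → List A → List (List A)
sublists []       = [] ∷ []
sublists (x ∷ xs) = sublists xs ++ map (x ∷_) (sublists xs)

incident : Vtx → Edge → Bool
incident x (a , b) = (a == x) ∨ (b == x)

degIn : List Edge → Vtx → ℕ
degIn M x = length (filterᵇ (incident x) M)

isPerfectMatching : Graph → List Edge → Bool
isPerfectMatching H M = and (map (λ x → degIn M x ≡ᵇ 1) (verts H))

Φ : Graph → ℕ
Φ H = length (filterᵇ (isPerfectMatching H) (sublists (edges H)))

record ℤ√5 : Set where
  constructor _+_√5
  field
    re : ℤ
    im : ℤ

_⊕_ : ℤ√5 → ℤ√5 → ℤ√5
(a + b √5) ⊕ (c + d √5) = (a +ℤ c) + (b +ℤ d) √5

_⊗_ : ℤ√5 → ℤ√5 → ℤ√5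
(a + b √5) ⊗ (c + d √5) = ((a *ℤ c) +ℤ ((+ 5) *ℤ (b *ℤ d))) + ((a *ℤ d) +ℤ (b *ℤ c)) √5

_^√_ : ℤ√5 → ℕ → ℤ√5
x ^√ zero  = (+ 1) + (+ 0) √5
x ^√ suc n = x ⊗ (x ^√ n)

fromℕ√ : ℕ → ℤ√5
fromℕ√ k = (+ k) + (+ 0) √5

-- Count more generally the edge sets with prescribed degrees: #factors vs es d is the number of
-- M ⊆ es with deg_M x = d x for every x ∈ vs, and Φ is the case d = 1. Committing to some edges M
-- lowers the targets to d ⊖ M, which is why targets are integers.
-- G (n+1) is a block of four squares (u₀, u₁, v₀, v₁, w₁, w₂, z₁, z₂ and the edges at them) glued
-- along u₂, v₂ to a copy of G n shifted two steps to the right. Summing over the edge sets of the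
-- block that saturate its private vertices leaves the shifted G n with targets 1 − deg u₂ and
-- 1 − deg v₂ at its first rung, and these are always (1,1) or (0,0). So p n = F n 1 1 and
-- q n = F n 0 0 satisfy p' = 2p + 4q, q' = p + 4q, whose eigenvalues are 3 ± √5; writing
-- (3 + √5)ⁿ = αₙ + βₙ√5 gives p = α + 3β and q = α + 2β, and 10(α + 3β) is the stated
-- combination of (3 ± √5)ⁿ, the minus part being the conjugate.

module Submission where

open import Defs
open import Data.Nat using (ℕ; _*_)
open import Data.Integer using (+_; -_)
open import Relation.Binary.PropositionalEquality using (_≡_)

open import Data.Nat using (zero; suc; _+_; _∸_)
import Data.Nat.Properties as ℕ
import Data.Nat.Tactic.RingSolver as ℕ-Solver
open import Data.Nat.ListAction using (sum)
open import Data.Nat.ListAction.Properties using (sum-++)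
open import Data.Integer using (ℤ; _≟_) renaming (_+_ to _+ℤ_; _-_ to _-ℤ_; _*_ to _*ℤ_)
import Data.Integer.Properties as ℤ
import Data.Integer.Tactic.RingSolver as ℤ-Solver
open import Data.Bool using (Bool; true; false; _∧_; _∨_; if_then_else_; T?)
import Data.Bool.Properties as Bool
open import Data.Bool.ListAction using (and; any)
open import Data.List using (List; []; _∷_; [_]; _++_; map; concat; length; filterᵇ; applyUpTo)
import Data.List.Properties as List
open import Data.List.Relation.Unary.Any using (here; there)
open import Data.List.Relation.Unary.All as All using (All; []; _∷_)
import Data.List.Relation.Unary.All.Properties as All
open import Data.List.Relation.Binary.Subset.Propositional using (_⊆_)
import Data.List.Relation.Binary.Subset.Propositional.Properties as ⊆
open import Data.List.Relation.Binary.Permutation.Propositional as ↭ using (_↭_; prep; swap)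
import Data.List.Relation.Binary.Permutation.Propositional.Properties as ↭
open import Data.List.Relation.Binary.Permutation.Setoid.Properties using (foldr-commMonoid)
open import Data.Product using (_×_; _,_; proj₁; uncurry)
import Data.Product as Prod
open import Data.Unit using (⊤)
open import Data.Empty using (⊥)
open import Function using (_∘_; _⇔_; mk⇔)
open import Relation.Nullary.Decidable using (does; does-⇔)
open import Relation.Binary.PropositionalEquality using (refl; sym; trans; cong; cong₂; module ≡-Reasoning)
open import Algebra.Bundles using (CommutativeMonoid)
open import Algebra.Properties.CommutativeSemigroup ℕ.+-commutativeSemigroup using (interchange)

private variable
  A B : Set

length-filterᵇ-++ : (p : A → Bool) (xs ys : List A) →
  length (filterᵇ p (xs ++ ys)) ≡ length (filterᵇ p xs) + length (filterᵇ p ys)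
length-filterᵇ-++ p xs ys = trans (cong length (List.filter-++ _ xs ys)) (List.length-++ (filterᵇ p xs))

length-filterᵇ-map : (p : B → Bool) (f : A → B) (xs : List A) →
  length (filterᵇ p (map f xs)) ≡ length (filterᵇ (p ∘ f) xs)
length-filterᵇ-map p f [] = refl
length-filterᵇ-map p f (x ∷ xs) with p (f x)
... | true  = cong suc (length-filterᵇ-map p f xs)
... | false = length-filterᵇ-map p f xs

filterᵇ-cong : {p q : A → Bool} {xs : List A} → All (λ x → p x ≡ q x) xs → filterᵇ p xs ≡ filterᵇ q xs
filterᵇ-cong [] = refl
filterᵇ-cong {p = p} {q} {x ∷ xs} (px≡qx ∷ h) with p x | q x
... | true  | true  = cong (x ∷_) (filterᵇ-cong h)
... | false | false = filterᵇ-cong h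
... | true  | false with () ← px≡qx
... | false | true  with () ← px≡qx

sum-map-if : (p : A → Bool) (f : A → ℕ) (xs : List A) →
  sum (map (λ x → if p x then f x else 0) xs) ≡ sum (map f (filterᵇ p xs))
sum-map-if p f [] = refl
sum-map-if p f (x ∷ xs) with p x
... | true  = cong (λ n → f x + n) (sum-map-if p f xs)
... | false = sum-map-if p f xs

and-++ : (bs cs : List Bool) → and (bs ++ cs) ≡ and bs ∧ and cs
and-++ [] cs = refl
and-++ (b ∷ bs) cs = trans (cong (b ∧_) (and-++ bs cs)) (sym (Bool.∧-assoc b (and bs) (and cs)))

sublists-map : (f : A → B) (xs : List A) → sublists (map f xs) ≡ map (map f) (sublists xs)
sublists-map f [] = refl
sublists-map f (x ∷ xs) = begin
    sublists (map f xs) ++ map (f x ∷_) (sublists (map f xs))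
  ≡⟨ cong (λ ss → ss ++ map (f x ∷_) ss) (sublists-map f xs) ⟩
    map (map f) (sublists xs) ++ map (f x ∷_) (map (map f) (sublists xs))
  ≡⟨ cong (map (map f) (sublists xs) ++_) (trans (sym (List.map-∘ (sublists xs))) (List.map-∘ (sublists xs))) ⟩
    map (map f) (sublists xs) ++ map (map f) (map (x ∷_) (sublists xs))
  ≡⟨ List.map-++ (map f) (sublists xs) _ ⟨
    map (map f) (sublists (x ∷ xs))
  ∎
  where open ≡-Reasoning

sublists-⊆ : (xs : List A) → All (_⊆ xs) (sublists xs)
sublists-⊆ [] = (λ ()) ∷ []
sublists-⊆ (x ∷ xs) = All.++⁺ (All.map widen (sublists-⊆ xs)) (All.map⁺ (All.map (⊆.∷⁺ʳ x) (sublists-⊆ xs)))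
  where
  widen : ∀ {M} → M ⊆ xs → M ⊆ x ∷ xs
  widen M⊆xs = ⊆.⊆-trans M⊆xs (⊆.xs⊆x∷xs xs x)

length-filterᵇ-∧ : (b : Bool) (p : A → Bool) (xs : List A) →
  length (filterᵇ (λ x → b ∧ p x) xs) ≡ (if b then length (filterᵇ p xs) else 0)
length-filterᵇ-∧ true  p xs = refl
length-filterᵇ-∧ false p [] = refl
length-filterᵇ-∧ false p (x ∷ xs) = length-filterᵇ-∧ false p xs

any≡false⇒All : {p : A → Bool} (xs : List A) → any p xs ≡ false → All (λ x → p x ≡ false) xs
any≡false⇒All [] _ = []
any≡false⇒All {p = p} (x ∷ xs) h with p x in px
... | false = px ∷ any≡false⇒All xs h

and-↭ : {bs cs : List Bool} → bs ↭ cs → and bs ≡ and cs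
and-↭ p = foldr-commMonoid ∧.setoid ∧.isCommutativeMonoid (↭.↭⇒↭ₛ p)
  where module ∧ = CommutativeMonoid Bool.∧-commutativeMonoid

+m+n≡i⇔+n≡i-+m : ∀ m n j → (+ (m + n) ≡ j) ⇔ (+ n ≡ j -ℤ + m)
+m+n≡i⇔+n≡i-+m m n j = mk⇔
  (λ { refl → trans (cancel (+ n) (+ m)) (cong (_-ℤ + m) (sym (ℤ.pos-+ m n))) })
  (λ n≡j-m → trans (ℤ.pos-+ m n) (trans (cong (+ m +ℤ_) n≡j-m) (restore (+ m) j)))
  where
  cancel : ∀ i k → i ≡ (k +ℤ i) -ℤ k
  cancel = ℤ-Solver.solve-∀
  restore : ∀ k i → k +ℤ (i -ℤ k) ≡ i
  restore = ℤ-Solver.solve-∀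

-- Edge sets with prescribed degrees

degIn-++ : ∀ M N x → degIn (M ++ N) x ≡ degIn M x + degIn N x
degIn-++ M N x = length-filterᵇ-++ (incident x) M N

degIn-avoided : ∀ {M es} y → M ⊆ es → All (λ e → incident y e ≡ false) es → degIn M y ≡ 0
degIn-avoided {[]} y M⊆es avoid = refl
degIn-avoided {e ∷ M} y M⊆es avoid with incident y e | All.lookup avoid (M⊆es (here refl))
... | .false | refl = degIn-avoided y (M⊆es ∘ there) avoid

_⊖_ : (Vtx → ℤ) → List Edge → Vtx → ℤ
(d ⊖ M) x = d x -ℤ + degIn M x

isFactor : List Vtx → (Vtx → ℤ) → List Edge → Bool
isFactor vs d M = and (map (λ x → does (+ degIn M x ≟ d x)) vs)

#factors : List Vtx → List Edge → (Vtx → ℤ) → ℕ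
#factors vs es d = length (filterᵇ (isFactor vs d) (sublists es))

isFactor-⊖ : ∀ vs d M N → isFactor vs (d ⊖ M) N ≡ isFactor vs d (M ++ N)
isFactor-⊖ vs d M N = cong and (List.map-cong agree vs)
  where
  agree : ∀ x → does (+ degIn N x ≟ (d ⊖ M) x) ≡ does (+ degIn (M ++ N) x ≟ d x)
  agree x rewrite degIn-++ M N x =
    sym (does-⇔ (+m+n≡i⇔+n≡i-+m (degIn M x) (degIn N x) (d x)) (+ (degIn M x + degIn N x) ≟ d x) (+ degIn N x ≟ (d ⊖ M) x))

#factors-resp : ∀ vs es d d' → (∀ M → isFactor vs d M ≡ isFactor vs d' M) → #factors vs es d ≡ #factors vs es d'
#factors-resp vs es d d' h = cong length (filterᵇ-cong (All.universal h (sublists es)))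

#factors-cong : ∀ vs es {d d'} → All (λ x → d x ≡ d' x) vs → #factors vs es d ≡ #factors vs es d'
#factors-cong vs es {d} {d'} h = #factors-resp vs es d d' λ M →
  cong and (List.map-cong-local (All.map (λ {x} → cong (λ t → does (+ degIn M x ≟ t))) h))

#factors-∷ : ∀ vs e es d → #factors vs (e ∷ es) d ≡ #factors vs es d + #factors vs es (d ⊖ [ e ])
#factors-∷ vs e es d = begin
    length (filterᵇ (isFactor vs d) (sublists es ++ map (e ∷_) (sublists es)))
  ≡⟨ length-filterᵇ-++ (isFactor vs d) (sublists es) _ ⟩
    #factors vs es d + length (filterᵇ (isFactor vs d) (map (e ∷_) (sublists es)))
  ≡⟨ cong (_+_ (#factors vs es d)) (length-filterᵇ-map (isFactor vs d) (e ∷_) (sublists es)) ⟩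
    #factors vs es d + length (filterᵇ (λ N → isFactor vs d (e ∷ N)) (sublists es))
  ≡⟨ cong (_+_ (#factors vs es d)) (cong length (filterᵇ-cong (All.universal (λ N → sym (isFactor-⊖ vs d [ e ] N)) (sublists es)))) ⟩
    #factors vs es d + #factors vs es (d ⊖ [ e ])
  ∎
  where open ≡-Reasoning

#factors-⊖-∷ : ∀ vs es d e M → #factors vs es ((d ⊖ [ e ]) ⊖ M) ≡ #factors vs es (d ⊖ (e ∷ M))
#factors-⊖-∷ vs es d e M = #factors-resp vs es ((d ⊖ [ e ]) ⊖ M) (d ⊖ (e ∷ M)) λ N → begin
    isFactor vs ((d ⊖ [ e ]) ⊖ M) N   ≡⟨ isFactor-⊖ vs (d ⊖ [ e ]) M N ⟩
    isFactor vs (d ⊖ [ e ]) (M ++ N)  ≡⟨ isFactor-⊖ vs d [ e ] (M ++ N) ⟩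
    isFactor vs d (e ∷ M ++ N)           ≡⟨ isFactor-⊖ vs d (e ∷ M) N ⟨
    isFactor vs (d ⊖ (e ∷ M)) N          ∎
  where open ≡-Reasoning

#factors-++ : ∀ vs es₁ es₂ d → #factors vs (es₁ ++ es₂) d ≡ sum (map (λ M → #factors vs es₂ (d ⊖ M)) (sublists es₁))
#factors-++ vs [] es₂ d = trans (#factors-resp vs es₂ d (d ⊖ []) (λ N → sym (isFactor-⊖ vs d [] N))) (sym (ℕ.+-identityʳ _))
#factors-++ vs (e ∷ es₁) es₂ d = begin
    #factors vs (e ∷ es₁ ++ es₂) d
  ≡⟨ #factors-∷ vs e (es₁ ++ es₂) d ⟩
    #factors vs (es₁ ++ es₂) d + #factors vs (es₁ ++ es₂) (d ⊖ [ e ])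
  ≡⟨ cong₂ _+_ (#factors-++ vs es₁ es₂ d) (#factors-++ vs es₁ es₂ (d ⊖ [ e ])) ⟩
    sum (map g (sublists es₁)) + sum (map (λ M → #factors vs es₂ ((d ⊖ [ e ]) ⊖ M)) (sublists es₁))
  ≡⟨ cong (λ t → sum (map g (sublists es₁)) + sum t)
       (trans (List.map-cong (#factors-⊖-∷ vs es₂ d e) (sublists es₁)) (List.map-∘ (sublists es₁))) ⟩
    sum (map g (sublists es₁)) + sum (map g (map (e ∷_) (sublists es₁)))
  ≡⟨ sum-++ (map g (sublists es₁)) _ ⟨
    sum (map g (sublists es₁) ++ map g (map (e ∷_) (sublists es₁)))
  ≡⟨ cong sum (List.map-++ g (sublists es₁) _) ⟨
    sum (map g (sublists (e ∷ es₁)))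
  ∎
  where
  open ≡-Reasoning
  g : List Edge → ℕ
  g M = #factors vs es₂ (d ⊖ M)

#factors-↭ᵛ : ∀ {vs vs'} es d → vs ↭ vs' → #factors vs es d ≡ #factors vs' es d
#factors-↭ᵛ es d p = cong length (filterᵇ-cong (All.universal (λ M → and-↭ (↭.map⁺ _ p)) (sublists es)))

#factors-↭ᵉ : ∀ vs {es es'} → es ↭ es' → ∀ d → #factors vs es d ≡ #factors vs es' d
#factors-↭ᵉ vs ↭.refl d = refl
#factors-↭ᵉ vs {e ∷ xs} {_ ∷ ys} (prep e p) d = begin
    #factors vs (e ∷ xs) d                                 ≡⟨ #factors-∷ vs e xs d ⟩
    #factors vs xs d + #factors vs xs (d ⊖ [ e ])          ≡⟨ cong₂ _+_ (#factors-↭ᵉ vs p d) (#factors-↭ᵉ vs p (d ⊖ [ e ])) ⟩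
    #factors vs ys d + #factors vs ys (d ⊖ [ e ])          ≡⟨ #factors-∷ vs e ys d ⟨
    #factors vs (e ∷ ys) d                                 ∎
  where open ≡-Reasoning
#factors-↭ᵉ vs {e₁ ∷ e₂ ∷ xs} {_ ∷ _ ∷ ys} (swap _ _ p) d = begin
    #factors vs (e₁ ∷ e₂ ∷ xs) d
  ≡⟨ twice e₁ e₂ xs ⟩
    (#factors vs xs d + #factors vs xs (d ⊖ [ e₂ ])) + (#factors vs xs (d ⊖ [ e₁ ]) + #factors vs xs ((d ⊖ [ e₁ ]) ⊖ [ e₂ ]))
  ≡⟨ interchange (#factors vs xs d) (#factors vs xs (d ⊖ [ e₂ ])) (#factors vs xs (d ⊖ [ e₁ ])) _ ⟩
    (#factors vs xs d + #factors vs xs (d ⊖ [ e₁ ])) + (#factors vs xs (d ⊖ [ e₂ ]) + #factors vs xs ((d ⊖ [ e₁ ]) ⊖ [ e₂ ]))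
  ≡⟨ cong₂ _+_ (cong₂ _+_ (#factors-↭ᵉ vs p d) (#factors-↭ᵉ vs p (d ⊖ [ e₁ ])))
               (cong₂ _+_ (#factors-↭ᵉ vs p (d ⊖ [ e₂ ])) (trans (#factors-↭ᵉ vs p ((d ⊖ [ e₁ ]) ⊖ [ e₂ ])) (#factors-cong vs ys {(d ⊖ [ e₁ ]) ⊖ [ e₂ ]} (All.universal ⊖-comm vs)))) ⟩
    (#factors vs ys d + #factors vs ys (d ⊖ [ e₁ ])) + (#factors vs ys (d ⊖ [ e₂ ]) + #factors vs ys ((d ⊖ [ e₂ ]) ⊖ [ e₁ ]))
  ≡⟨ twice e₂ e₁ ys ⟨
    #factors vs (e₂ ∷ e₁ ∷ ys) d
  ∎
  where
  open ≡-Reasoning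
  twice : ∀ a b zs → #factors vs (a ∷ b ∷ zs) d
    ≡ (#factors vs zs d + #factors vs zs (d ⊖ [ b ])) + (#factors vs zs (d ⊖ [ a ]) + #factors vs zs ((d ⊖ [ a ]) ⊖ [ b ]))
  twice a b zs = trans (#factors-∷ vs a (b ∷ zs) d) (cong₂ _+_ (#factors-∷ vs b zs d) (#factors-∷ vs b zs (d ⊖ [ a ])))
  ⊖-comm : ∀ x → ((d ⊖ [ e₁ ]) ⊖ [ e₂ ]) x ≡ ((d ⊖ [ e₂ ]) ⊖ [ e₁ ]) x
  ⊖-comm x = exchange (d x) (+ degIn [ e₁ ] x) (+ degIn [ e₂ ] x)
    where
    exchange : ∀ j a b → (j -ℤ a) -ℤ b ≡ (j -ℤ b) -ℤ a
    exchange = ℤ-Solver.solve-∀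
#factors-↭ᵉ vs (↭.trans p q) d = trans (#factors-↭ᵉ vs p d) (#factors-↭ᵉ vs q d)

module _ (f : Vtx → Vtx) (f-== : ∀ x y → (f x == f y) ≡ (x == y)) where

  degIn-map : ∀ M x → degIn (map (Prod.map f f) M) (f x) ≡ degIn M x
  degIn-map M x = trans (length-filterᵇ-map (incident (f x)) (Prod.map f f) M)
    (cong length (filterᵇ-cong (All.universal (λ (a , b) → cong₂ _∨_ (f-== a x) (f-== b x)) M)))

  #factors-map : ∀ vs es d → #factors (map f vs) (map (Prod.map f f) es) d ≡ #factors vs es (d ∘ f)
  #factors-map vs es d = begin
      length (filterᵇ (isFactor (map f vs) d) (sublists (map (Prod.map f f) es)))
    ≡⟨ cong (length ∘ filterᵇ (isFactor (map f vs) d)) (sublists-map (Prod.map f f) es) ⟩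
      length (filterᵇ (isFactor (map f vs) d) (map (map (Prod.map f f)) (sublists es)))
    ≡⟨ length-filterᵇ-map (isFactor (map f vs) d) (map (Prod.map f f)) (sublists es) ⟩
      length (filterᵇ (isFactor (map f vs) d ∘ map (Prod.map f f)) (sublists es))
    ≡⟨ cong length (filterᵇ-cong (All.universal relabel (sublists es))) ⟩
      #factors vs es (d ∘ f)
    ∎
    where
    open ≡-Reasoning
    relabel : ∀ M → isFactor (map f vs) d (map (Prod.map f f) M) ≡ isFactor vs (d ∘ f) M
    relabel M = cong and (trans (sym (List.map-∘ vs))
      (List.map-cong (λ x → cong (λ k → does (+ k ≟ d (f x))) (degIn-map M x)) vs))

Isolated : List Vtx → List Edge → Set
Isolated vs es = All (λ e → All (λ x → incident x e ≡ false) vs) es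

isFactor-isolated : ∀ vs d {M es} → M ⊆ es → Isolated vs es → isFactor vs d M ≡ isFactor vs d []
isFactor-isolated vs d M⊆es iso = cong and (List.map-cong-local (All.tabulate λ {x} x∈vs →
  cong (λ k → does (+ k ≟ d x)) (degIn-avoided x M⊆es (All.map (λ avoid → All.lookup avoid x∈vs) iso))))

#factors-isolated : ∀ vs₁ vs₂ es d → Isolated vs₁ es →
  #factors (vs₁ ++ vs₂) es d ≡ (if isFactor vs₁ d [] then #factors vs₂ es d else 0)
#factors-isolated vs₁ vs₂ es d iso = begin
    #factors (vs₁ ++ vs₂) es d
  ≡⟨ cong length (filterᵇ-cong (All.map split (sublists-⊆ es))) ⟩
    length (filterᵇ (λ M → isFactor vs₁ d [] ∧ isFactor vs₂ d M) (sublists es))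
  ≡⟨ length-filterᵇ-∧ (isFactor vs₁ d []) (isFactor vs₂ d) (sublists es) ⟩
    (if isFactor vs₁ d [] then #factors vs₂ es d else 0)
  ∎
  where
  open ≡-Reasoning
  split : ∀ {M} → M ⊆ es → isFactor (vs₁ ++ vs₂) d M ≡ isFactor vs₁ d [] ∧ isFactor vs₂ d M
  split {M} M⊆es = trans (cong and (List.map-++ _ vs₁ vs₂))
    (trans (and-++ (map _ vs₁) _) (cong (_∧ isFactor vs₂ d M) (isFactor-isolated vs₁ d M⊆es iso)))

#factors-glue : ∀ vs₁ vs₂ es₁ es₂ d → Isolated vs₁ es₂ →
  #factors (vs₁ ++ vs₂) (es₁ ++ es₂) d ≡ sum (map (λ M → #factors vs₂ es₂ (d ⊖ M)) (filterᵇ (isFactor vs₁ d) (sublists es₁)))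
#factors-glue vs₁ vs₂ es₁ es₂ d iso = begin
    #factors (vs₁ ++ vs₂) (es₁ ++ es₂) d
  ≡⟨ #factors-++ (vs₁ ++ vs₂) es₁ es₂ d ⟩
    sum (map (λ M → #factors (vs₁ ++ vs₂) es₂ (d ⊖ M)) (sublists es₁))
  ≡⟨ cong sum (List.map-cong (λ M → trans (#factors-isolated vs₁ vs₂ es₂ (d ⊖ M) iso)
       (cong (λ b → if b then #factors vs₂ es₂ (d ⊖ M) else 0) (saturated M))) (sublists es₁)) ⟩
    sum (map (λ M → if isFactor vs₁ d M then #factors vs₂ es₂ (d ⊖ M) else 0) (sublists es₁))
  ≡⟨ sum-map-if (isFactor vs₁ d) (λ M → #factors vs₂ es₂ (d ⊖ M)) (sublists es₁) ⟩
    sum (map (λ M → #factors vs₂ es₂ (d ⊖ M)) (filterᵇ (isFactor vs₁ d) (sublists es₁)))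
  ∎
  where
  open ≡-Reasoning
  saturated : ∀ M → isFactor vs₁ (d ⊖ M) [] ≡ isFactor vs₁ d M
  saturated M = trans (isFactor-⊖ vs₁ d M []) (cong (isFactor vs₁ d) (List.++-identityʳ M))

-- The graphs G n as a block followed by a shifted copy of G (n − 1)

map-shift : {f : A → B} {s : A → A} {h : B → B} → (∀ i → f (s i) ≡ h (f i)) →
  (xs : List A) → map f (map s xs) ≡ map h (map f xs)
map-shift comm xs = trans (sym (List.map-∘ xs)) (trans (List.map-cong comm xs) (List.map-∘ xs))

concat-map-shift : {f : A → List B} {s : A → A} {h : B → B} {xs : List A} →
  All (λ i → f (s i) ≡ map h (f i)) xs → concat (map f (map s xs)) ≡ map h (concat (map f xs))
concat-map-shift {f = f} {s} {h} {xs} comm = begin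
  concat (map f (map s xs))        ≡⟨ cong concat (List.map-∘ xs) ⟨
  concat (map (f ∘ s) xs)          ≡⟨ cong concat (List.map-cong-local comm) ⟩
  concat (map (map h ∘ f) xs)      ≡⟨ cong concat (List.map-∘ xs) ⟩
  concat (map (map h) (map f xs))  ≡⟨ List.concat-map (map f xs) ⟩
  map h (concat (map f xs))        ∎
  where open ≡-Reasoning

shuffle₄ : (g : A → A) (h₁ t₁ h₂ t₂ h₃ t₃ h₄ t₄ : List A) →
  (h₁ ++ map g t₁) ++ (h₂ ++ map g t₂) ++ (h₃ ++ map g t₃) ++ (h₄ ++ map g t₄)
    ↭ (h₁ ++ h₂ ++ h₃ ++ h₄) ++ map g (t₁ ++ t₂ ++ t₃ ++ t₄)
shuffle₄ g h₁ t₁ h₂ t₂ h₃ t₃ h₄ t₄ = begin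
    (h₁ ++ x₁) ++ (h₂ ++ x₂) ++ (h₃ ++ x₃) ++ (h₄ ++ x₄)
  ↭⟨ ↭.++⁺ˡ (h₁ ++ x₁) (↭.++⁺ˡ (h₂ ++ x₂) (interleave h₃ x₃ h₄ x₄)) ⟩
    (h₁ ++ x₁) ++ (h₂ ++ x₂) ++ (h₃ ++ h₄) ++ (x₃ ++ x₄)
  ↭⟨ ↭.++⁺ˡ (h₁ ++ x₁) (interleave h₂ x₂ (h₃ ++ h₄) (x₃ ++ x₄)) ⟩
    (h₁ ++ x₁) ++ (h₂ ++ h₃ ++ h₄) ++ (x₂ ++ x₃ ++ x₄)
  ↭⟨ interleave h₁ x₁ (h₂ ++ h₃ ++ h₄) (x₂ ++ x₃ ++ x₄) ⟩
    (h₁ ++ h₂ ++ h₃ ++ h₄) ++ (x₁ ++ x₂ ++ x₃ ++ x₄)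
  ≡⟨ cong ((h₁ ++ h₂ ++ h₃ ++ h₄) ++_) (map-++₄ t₁ t₂ t₃ t₄) ⟨
    (h₁ ++ h₂ ++ h₃ ++ h₄) ++ map g (t₁ ++ t₂ ++ t₃ ++ t₄)
  ∎
  where
  open ↭.PermutationReasoning
  x₁ = map g t₁
  x₂ = map g t₂
  x₃ = map g t₃
  x₄ = map g t₄
  interleave : (p x q y : List _) → (p ++ x) ++ (q ++ y) ↭ (p ++ q) ++ (x ++ y)
  interleave p x q y = begin
    (p ++ x) ++ (q ++ y)  ≡⟨ List.++-assoc p x (q ++ y) ⟩
    p ++ x ++ q ++ y      ↭⟨ ↭.++⁺ˡ p (↭.shifts x q) ⟩
    p ++ q ++ x ++ y      ≡⟨ List.++-assoc p q (x ++ y) ⟨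
    (p ++ q) ++ (x ++ y)  ∎
  map-++₄ : ∀ a b c d → map g (a ++ b ++ c ++ d) ≡ map g a ++ map g b ++ map g c ++ map g d
  map-++₄ a b c d = trans (List.map-++ g a _) (cong (map g a ++_)
    (trans (List.map-++ g b _) (cong (map g b ++_) (List.map-++ g c d))))

shift : Vtx → Vtx
shift (u i) = u (2 + i)
shift (v i) = v (2 + i)
shift (w i) = w (2 + i)
shift (z i) = z (2 + i)

shift-== : ∀ x y → (shift x == shift y) ≡ (x == y)
shift-== (u i) (u j) = refl
shift-== (u i) (v j) = refl
shift-== (u i) (w j) = refl
shift-== (u i) (z j) = refl
shift-== (v i) (u j) = refl
shift-== (v i) (v j) = refl
shift-== (v i) (w j) = refl
shift-== (v i) (z j) = refl
shift-== (w i) (u j) = refl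
shift-== (w i) (v j) = refl
shift-== (w i) (w j) = refl
shift-== (w i) (z j) = refl
shift-== (z i) (u j) = refl
shift-== (z i) (v j) = refl
shift-== (z i) (w j) = refl
shift-== (z i) (z j) = refl

shiftE : Edge → Edge
shiftE = Prod.map shift shift

zeroTo oneTo : ℕ → List ℕ
zeroTo n = applyUpTo (λ i → i) (suc (2 * n))
oneTo n = applyUpTo suc (2 * n)

rung : ℕ → Edge
rung i = (u i , v i)

path pendant cap : ℕ → List Edge
path i = (u (i ∸ 1) , u i) ∷ (v (i ∸ 1) , v i) ∷ []
pendant i = (w i , u i) ∷ (v i , z i) ∷ []
cap j = (w (2 * j + 1) , w (2 * j + 2)) ∷ (z (2 * j + 1) , z (2 * j + 2)) ∷ []

vertexList : List ℕ → List ℕ → List Vtx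
vertexList Z O = map u Z ++ map v Z ++ map w O ++ map z O

edgeList : List ℕ → List ℕ → List ℕ → List Edge
edgeList Z O I = concat (map path O) ++ map rung Z ++ concat (map pendant O) ++ concat (map cap I)

-- For n ≥ 1 these are the vertex and edge lists of G n; for n = 0 they describe the single edge u₀v₀.
Vs : ℕ → List Vtx
Vs n = vertexList (zeroTo n) (oneTo n)

Es : ℕ → List Edge
Es n = edgeList (zeroTo n) (oneTo n) (applyUpTo (λ i → i) n)

blockV : List Vtx
blockV = u 0 ∷ u 1 ∷ v 0 ∷ v 1 ∷ w 1 ∷ w 2 ∷ z 1 ∷ z 2 ∷ []

blockE : List Edge
blockE = path 1 ++ path 2 ++ rung 0 ∷ rung 1 ∷ pendant 1 ++ pendant 2 ++ cap 0

zeroTo-suc : ∀ n → zeroTo (suc n) ≡ 0 ∷ 1 ∷ map (λ i → 2 + i) (zeroTo n)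
zeroTo-suc n = trans (cong (λ m → applyUpTo (λ i → i) (suc m)) (ℕ.*-suc 2 n))
  (cong (λ is → 0 ∷ 1 ∷ 2 ∷ is) (sym (List.map-applyUpTo suc (λ i → 2 + i) (2 * n))))

oneTo-suc : ∀ n → oneTo (suc n) ≡ 1 ∷ 2 ∷ map (λ i → 2 + i) (oneTo n)
oneTo-suc n = trans (cong (applyUpTo suc) (ℕ.*-suc 2 n))
  (cong (λ is → 1 ∷ 2 ∷ is) (sym (List.map-applyUpTo suc (λ i → 2 + i) (2 * n))))

cap-suc : ∀ j → cap (suc j) ≡ map shiftE (cap j)
cap-suc j = cong capFrom (ℕ.*-suc 2 j)
  where
  capFrom : ℕ → List Edge
  capFrom m = (w (m + 1) , w (m + 2)) ∷ (z (m + 1) , z (m + 2)) ∷ []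

Vs-suc : ∀ n → Vs (suc n) ↭ blockV ++ map shift (Vs n)
Vs-suc n = begin
    Vs (suc n)
  ≡⟨ cong₂ vertexList (zeroTo-suc n) (oneTo-suc n) ⟩
    vertexList (0 ∷ 1 ∷ map (λ i → 2 + i) Z) (1 ∷ 2 ∷ map (λ i → 2 + i) O)
  ≡⟨ cong₂ _++_ (cong (λ t → u 0 ∷ u 1 ∷ t) (map-shift (λ _ → refl) Z)) (cong₂ _++_ (cong (λ t → v 0 ∷ v 1 ∷ t) (map-shift (λ _ → refl) Z))
       (cong₂ _++_ (cong (λ t → w 1 ∷ w 2 ∷ t) (map-shift (λ _ → refl) O)) (cong (λ t → z 1 ∷ z 2 ∷ t) (map-shift (λ _ → refl) O)))) ⟩
    (u 0 ∷ u 1 ∷ map shift (map u Z)) ++ (v 0 ∷ v 1 ∷ map shift (map v Z))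
      ++ (w 1 ∷ w 2 ∷ map shift (map w O)) ++ (z 1 ∷ z 2 ∷ map shift (map z O))
  ↭⟨ shuffle₄ shift (u 0 ∷ u 1 ∷ []) (map u Z) (v 0 ∷ v 1 ∷ []) (map v Z)
                    (w 1 ∷ w 2 ∷ []) (map w O) (z 1 ∷ z 2 ∷ []) (map z O) ⟩
    blockV ++ map shift (Vs n)
  ∎
  where
  open ↭.PermutationReasoning
  Z = zeroTo n
  O = oneTo n

Es-suc : ∀ n → Es (suc n) ↭ blockE ++ map shiftE (Es n)
Es-suc n = begin
    Es (suc n)
  ≡⟨ cong₂ (λ Z′ O′ → edgeList Z′ O′ (0 ∷ applyUpTo suc n)) (zeroTo-suc n) (oneTo-suc n) ⟩
    edgeList (0 ∷ 1 ∷ map (λ i → 2 + i) Z) (1 ∷ 2 ∷ map (λ i → 2 + i) O) (0 ∷ applyUpTo suc n)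
  ≡⟨ cong₂ _++_ (cong (λ t → path 1 ++ path 2 ++ t) (concat-map-shift (All.applyUpTo⁺₂ suc (2 * n) (λ _ → refl))))
       (cong₂ _++_ (cong (λ t → rung 0 ∷ rung 1 ∷ t) (map-shift (λ _ → refl) Z))
       (cong₂ _++_ (cong (λ t → pendant 1 ++ pendant 2 ++ t) (concat-map-shift (All.universal (λ _ → refl) O)))
                   (cong (cap 0 ++_) caps))) ⟩
    (path 1 ++ path 2 ++ map shiftE (concat (map path O))) ++ (rung 0 ∷ rung 1 ∷ map shiftE (map rung Z))
      ++ (pendant 1 ++ pendant 2 ++ map shiftE (concat (map pendant O))) ++ (cap 0 ++ map shiftE (concat (map cap I)))
  ↭⟨ shuffle₄ shiftE (path 1 ++ path 2) (concat (map path O)) (rung 0 ∷ rung 1 ∷ []) (map rung Z)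
                     (pendant 1 ++ pendant 2) (concat (map pendant O)) (cap 0) (concat (map cap I)) ⟩
    blockE ++ map shiftE (Es n)
  ∎
  where
  open ↭.PermutationReasoning
  Z = zeroTo n
  O = oneTo n
  I = applyUpTo (λ i → i) n
  caps : concat (map cap (applyUpTo suc n)) ≡ map shiftE (concat (map cap I))
  caps = trans (cong (concat ∘ map cap) (sym (List.map-applyUpTo (λ i → i) suc n)))
               (concat-map-shift (All.universal cap-suc I))

-- w 0 and z 0 are not vertices of any G n; excluding them keeps shifted edges off the block (shift (w 0) = w 2).
WellIndexed : Vtx → Set
WellIndexed (w zero) = ⊥
WellIndexed (z zero) = ⊥
WellIndexed _        = ⊤

WellIndexedEdge : Edge → Set
WellIndexedEdge (a , b) = WellIndexed a × WellIndexed b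

Vs-wellIndexed : ∀ n → All WellIndexed (Vs n)
Vs-wellIndexed n = All.++⁺ (All.map⁺ (All.universal _ (zeroTo n))) (All.++⁺ (All.map⁺ (All.universal _ (zeroTo n)))
  (All.++⁺ (All.map⁺ (All.applyUpTo⁺₂ suc (2 * n) _)) (All.map⁺ (All.applyUpTo⁺₂ suc (2 * n) _))))

Es-wellIndexed : ∀ n → All WellIndexedEdge (Es n)
Es-wellIndexed n = All.++⁺ (All.concat⁺ (All.map⁺ (All.applyUpTo⁺₂ suc (2 * n) λ _ → (_ , _) ∷ (_ , _) ∷ [])))
  (All.++⁺ (All.map⁺ (All.universal _ (zeroTo n)))
  (All.++⁺ (All.concat⁺ (All.map⁺ (All.applyUpTo⁺₂ suc (2 * n) λ _ → (_ , _) ∷ (_ , _) ∷ [])))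
           (All.concat⁺ (All.map⁺ (All.universal capWellIndexed (applyUpTo (λ i → i) n))))))
  where
  capWellIndexed : ∀ j → All WellIndexedEdge (cap j)
  capWellIndexed j rewrite ℕ.+-suc (2 * j) 0 | ℕ.+-suc (2 * j) 1 = (_ , _) ∷ (_ , _) ∷ []

shift-avoids-block : ∀ x → WellIndexed x → All (λ y → (shift x == y) ≡ false) blockV
shift-avoids-block (u i)       _ = any≡false⇒All blockV refl
shift-avoids-block (v i)       _ = any≡false⇒All blockV refl
shift-avoids-block (w (suc i)) _ = any≡false⇒All blockV refl
shift-avoids-block (z (suc i)) _ = any≡false⇒All blockV refl

block-isolated : ∀ n → Isolated blockV (map shiftE (Es n))
block-isolated n = All.map⁺ (All.map avoids (Es-wellIndexed n))
  where
  avoids : ∀ {e} → WellIndexedEdge e → All (λ y → incident y (shiftE e) ≡ false) blockV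
  avoids {a , b} (wa , wb) = All.zipWith (λ (p , q) → cong₂ _∨_ p q) (shift-avoids-block a wa , shift-avoids-block b wb)

-- The transfer recurrence

boundary : ℤ → ℤ → Vtx → ℤ
boundary a b (u zero) = a
boundary a b (v zero) = b
boundary a b _        = + 1

-- F n 1 1 counts the perfect matchings of G n (n ≥ 1), F n 0 0 those of G n − u₀ − v₀.
F : ℕ → ℤ → ℤ → ℕ
F n a b = #factors (Vs n) (Es n) (boundary a b)

-- The targets that block edges M leave at u₂ and v₂, the images of u₀ and v₀ under shift.
carry : List Edge → ℤ × ℤ
carry M = + 1 -ℤ + degIn M (u 2) , + 1 -ℤ + degIn M (v 2)

shifted-boundary : ∀ a b {M} → M ⊆ blockE → ∀ x → WellIndexed x →
  (boundary a b ⊖ M) (shift x) ≡ uncurry boundary (carry M) x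
shifted-boundary a b M⊆ (u zero)    _ = refl
shifted-boundary a b M⊆ (v zero)    _ = refl
shifted-boundary a b M⊆ (u (suc i)) _ = cong (λ k → + 1 -ℤ + k) (degIn-avoided _ M⊆ (any≡false⇒All blockE refl))
shifted-boundary a b M⊆ (v (suc i)) _ = cong (λ k → + 1 -ℤ + k) (degIn-avoided _ M⊆ (any≡false⇒All blockE refl))
shifted-boundary a b M⊆ (w (suc i)) _ = cong (λ k → + 1 -ℤ + k) (degIn-avoided _ M⊆ (any≡false⇒All blockE refl))
shifted-boundary a b M⊆ (z (suc i)) _ = cong (λ k → + 1 -ℤ + k) (degIn-avoided _ M⊆ (any≡false⇒All blockE refl))

transitions : ℤ → ℤ → List (ℤ × ℤ)
transitions a b = map carry (filterᵇ (isFactor blockV (boundary a b)) (sublists blockE))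

F-suc : ∀ n a b → F (suc n) a b ≡ sum (map (uncurry (F n)) (transitions a b))
F-suc n a b = begin
    F (suc n) a b
  ≡⟨ #factors-↭ᵛ (Es (suc n)) d (Vs-suc n) ⟩
    #factors (blockV ++ map shift (Vs n)) (Es (suc n)) d
  ≡⟨ #factors-↭ᵉ (blockV ++ map shift (Vs n)) (Es-suc n) d ⟩
    #factors (blockV ++ map shift (Vs n)) (blockE ++ map shiftE (Es n)) d
  ≡⟨ #factors-glue blockV (map shift (Vs n)) blockE (map shiftE (Es n)) d (block-isolated n) ⟩
    sum (map (λ M → #factors (map shift (Vs n)) (map shiftE (Es n)) (d ⊖ M)) saturating)
  ≡⟨ cong sum (List.map-cong-local (All.map unshift (All.filter⁺ (T? ∘ isFactor blockV d) (sublists-⊆ blockE)))) ⟩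
    sum (map (uncurry (F n) ∘ carry) saturating)
  ≡⟨ cong sum (List.map-∘ saturating) ⟩
    sum (map (uncurry (F n)) (transitions a b))
  ∎
  where
  open ≡-Reasoning
  d = boundary a b
  saturating = filterᵇ (isFactor blockV d) (sublists blockE)
  unshift : ∀ {M} → M ⊆ blockE → #factors (map shift (Vs n)) (map shiftE (Es n)) (d ⊖ M) ≡ uncurry (F n) (carry M)
  unshift {M} M⊆ = trans (#factors-map shift shift-== (Vs n) (Es n) (d ⊖ M))
    (#factors-cong (Vs n) (Es n) {(d ⊖ M) ∘ shift} (All.map (shifted-boundary a b M⊆ _) (Vs-wellIndexed n)))

transitions-11 : transitions (+ 1) (+ 1) ≡ (+ 0 , + 0) ∷ (+ 1 , + 1) ∷ (+ 0 , + 0) ∷ (+ 0 , + 0) ∷ (+ 0 , + 0) ∷ (+ 1 , + 1) ∷ []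
transitions-11 = refl

transitions-00 : transitions (+ 0) (+ 0) ≡ (+ 0 , + 0) ∷ (+ 1 , + 1) ∷ (+ 0 , + 0) ∷ (+ 0 , + 0) ∷ (+ 0 , + 0) ∷ []
transitions-00 = refl

F-suc-11 : ∀ n → F (suc n) (+ 1) (+ 1) ≡ 2 * F n (+ 1) (+ 1) + 4 * F n (+ 0) (+ 0)
F-suc-11 n = begin
    F (suc n) (+ 1) (+ 1)                             ≡⟨ F-suc n (+ 1) (+ 1) ⟩
    sum (map (uncurry (F n)) (transitions (+ 1) (+ 1))) ≡⟨ cong (sum ∘ map (uncurry (F n))) transitions-11 ⟩
    y + (x + (y + (y + (y + (x + 0)))))               ≡⟨ collect x y ⟩
    2 * x + 4 * y                                     ∎
  where
  open ≡-Reasoning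
  x = F n (+ 1) (+ 1)
  y = F n (+ 0) (+ 0)
  collect : ∀ x y → y + (x + (y + (y + (y + (x + 0))))) ≡ 2 * x + 4 * y
  collect = ℕ-Solver.solve-∀

F-suc-00 : ∀ n → F (suc n) (+ 0) (+ 0) ≡ F n (+ 1) (+ 1) + 4 * F n (+ 0) (+ 0)
F-suc-00 n = begin
    F (suc n) (+ 0) (+ 0)                             ≡⟨ F-suc n (+ 0) (+ 0) ⟩
    sum (map (uncurry (F n)) (transitions (+ 0) (+ 0))) ≡⟨ cong (sum ∘ map (uncurry (F n))) transitions-00 ⟩
    y + (x + (y + (y + (y + 0))))                     ≡⟨ collect x y ⟩
    x + 4 * y                                         ∎
  where
  open ≡-Reasoning
  x = F n (+ 1) (+ 1)
  y = F n (+ 0) (+ 0)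
  collect : ∀ x y → y + (x + (y + (y + (y + 0)))) ≡ x + 4 * y
  collect = ℕ-Solver.solve-∀

-- Closed form in ℤ[√5]

α β : ℕ → ℕ
α zero    = 1
α (suc n) = 3 * α n + 5 * β n
β zero    = 0
β (suc n) = α n + 3 * β n

F-closed : ∀ n → (F n (+ 1) (+ 1) ≡ α n + 3 * β n) × (F n (+ 0) (+ 0) ≡ α n + 2 * β n)
F-closed zero = refl , refl
F-closed (suc n) with F-closed n
... | f₁₁ , f₀₀ =
  trans (F-suc-11 n) (trans (cong₂ (λ x y → 2 * x + 4 * y) f₁₁ f₀₀) (step₁₁ (α n) (β n))) ,
  trans (F-suc-00 n) (trans (cong₂ (λ x y → x + 4 * y) f₁₁ f₀₀) (step₀₀ (α n) (β n)))
  where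
  step₁₁ : ∀ a b → 2 * (a + 3 * b) + 4 * (a + 2 * b) ≡ (3 * a + 5 * b) + 3 * (a + 3 * b)
  step₁₁ = ℕ-Solver.solve-∀
  step₀₀ : ∀ a b → (a + 3 * b) + 4 * (a + 2 * b) ≡ (3 * a + 5 * b) + 2 * (a + 3 * b)
  step₀₀ = ℕ-Solver.solve-∀

pos-+-* : ∀ a k b → + (a + k * b) ≡ + a +ℤ + k *ℤ + b
pos-+-* a k b = trans (ℤ.pos-+ a (k * b)) (cong (+ a +ℤ_) (ℤ.pos-* k b))

conj : ℤ√5 → ℤ√5
conj (x + y √5) = x + (- y) √5

conj-⊗ : ∀ p q → conj (p ⊗ q) ≡ conj p ⊗ conj q
conj-⊗ (a + b √5) (c + d √5) = cong₂ _+_√5 (re a b c d) (im a b c d)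
  where
  re : ∀ a b c d → a *ℤ c +ℤ + 5 *ℤ (b *ℤ d) ≡ a *ℤ c +ℤ + 5 *ℤ (- b *ℤ - d)
  re = ℤ-Solver.solve-∀
  im : ∀ a b c d → - (a *ℤ d +ℤ b *ℤ c) ≡ a *ℤ - d +ℤ - b *ℤ c
  im = ℤ-Solver.solve-∀

conj-^√ : ∀ p n → conj (p ^√ n) ≡ conj p ^√ n
conj-^√ p zero    = refl
conj-^√ p (suc n) = trans (conj-⊗ p (p ^√ n)) (cong (conj p ⊗_) (conj-^√ p n))

pow-3+√5 : ∀ n → ((+ 3) + (+ 1) √5) ^√ n ≡ (+ α n) + (+ β n) √5
pow-3+√5 zero    = refl
pow-3+√5 (suc n) rewrite pow-3+√5 n = cong₂ _+_√5
  (trans (re (+ α n) (+ β n)) (sym (trans (ℤ.pos-+ (3 * α n) (5 * β n)) (cong₂ _+ℤ_ (ℤ.pos-* 3 (α n)) (ℤ.pos-* 5 (β n))))))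
  (trans (im (+ α n) (+ β n)) (sym (pos-+-* (α n) 3 (β n))))
  where
  re : ∀ a b → + 3 *ℤ a +ℤ + 5 *ℤ (+ 1 *ℤ b) ≡ + 3 *ℤ a +ℤ + 5 *ℤ b
  re = ℤ-Solver.solve-∀
  im : ∀ a b → + 3 *ℤ b +ℤ + 1 *ℤ a ≡ a +ℤ + 3 *ℤ b
  im = ℤ-Solver.solve-∀

ten-times : ∀ a b → fromℕ√ (10 * (a + 3 * b))
  ≡ (((+ 5) + (- (+ 3)) √5) ⊗ conj ((+ a) + (+ b) √5)) ⊕ (((+ 5) + (+ 3) √5) ⊗ ((+ a) + (+ b) √5))
ten-times a b = cong₂ _+_√5
  (trans (ℤ.pos-* 10 (a + 3 * b)) (trans (cong (+ 10 *ℤ_) (pos-+-* a 3 b)) (re (+ a) (+ b))))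
  (im (+ a) (+ b))
  where
  re : ∀ x y → + 10 *ℤ (x +ℤ + 3 *ℤ y) ≡ (+ 5 *ℤ x +ℤ + 5 *ℤ (- (+ 3) *ℤ - y)) +ℤ (+ 5 *ℤ x +ℤ + 5 *ℤ (+ 3 *ℤ y))
  re = ℤ-Solver.solve-∀
  im : ∀ x y → + 0 ≡ (+ 5 *ℤ - y +ℤ - (+ 3) *ℤ x) +ℤ (+ 5 *ℤ y +ℤ + 3 *ℤ x)
  im = ℤ-Solver.solve-∀

Φ≡F : ∀ k → Φ (G (suc k)) ≡ F (suc k) (+ 1) (+ 1)
Φ≡F k = #factors-cong (Vs (suc k)) (Es (suc k)) (All.universal unit-target (Vs (suc k)))
  where
  unit-target : ∀ x → + 1 ≡ boundary (+ 1) (+ 1) x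
  unit-target (u zero)    = refl
  unit-target (u (suc i)) = refl
  unit-target (v zero)    = refl
  unit-target (v (suc i)) = refl
  unit-target (w i)       = refl
  unit-target (z i)       = refl

theorem2p2 : (n : ℕ) → fromℕ√ (10 * Φ (G n)) ≡ (((+ 5) + (- (+ 3)) √5) ⊗ (((+ 3) + (- (+ 1)) √5) ^√ n)) ⊕ (((+ 5) + (+ 3) √5) ⊗ (((+ 3) + (+ 1) √5) ^√ n))
theorem2p2 zero = refl
theorem2p2 (suc k) = begin
    fromℕ√ (10 * Φ (G n))
  ≡⟨ cong (λ m → fromℕ√ (10 * m)) (trans (Φ≡F k) (proj₁ (F-closed n))) ⟩
    fromℕ√ (10 * (α n + 3 * β n))
  ≡⟨ ten-times (α n) (β n) ⟩
    (((+ 5) + (- (+ 3)) √5) ⊗ conj ((+ α n) + (+ β n) √5)) ⊕ (((+ 5) + (+ 3) √5) ⊗ ((+ α n) + (+ β n) √5))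
  ≡⟨ cong₂ (λ p q → (((+ 5) + (- (+ 3)) √5) ⊗ p) ⊕ (((+ 5) + (+ 3) √5) ⊗ q))
       (trans (cong conj (sym (pow-3+√5 n))) (conj-^√ ((+ 3) + (+ 1) √5) n)) (sym (pow-3+√5 n)) ⟩
    (((+ 5) + (- (+ 3)) √5) ⊗ (((+ 3) + (- (+ 1)) √5) ^√ n)) ⊕ (((+ 5) + (+ 3) √5) ⊗ (((+ 3) + (+ 1) √5) ^√ n))
  ∎
  where
  open ≡-Reasoning
  n = suc k
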